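{- Let $(B,\leq,0,1,+,C)$ be a distributive contact join-semilattice, $m,i\geq 1$, and let $x,s_j^l\in B$ ($1\leq j\leq m$, $1\leq l\leq i$) satisfy $x=s_1^1+\dots+s_1^i=s_2^1+\dots+s_2^i=\dots=s_m^1+\dots+s_m^i$. Then there exist $n\geq 1$ and $t_1,\dots,t_n\in B$ such that $x=t_1+\dots+t_n$ and for every $j\in\{1,\dots,n\}$ there are $l_1,\dots,l_m\in\{1,\dots,i\}$ with $t_j\leq s_1^{l_1},\dots,t_j\leq s_m^{l_m}$.
   Context: A distributive contact join-semilattice (DCJS) is a structure $(B,\leq,0,1,+,C)$ ($0,1\in B$, $+$ binary operation, $\leq,C$ binary relations) satisfying for all elements: (1) $x\leq x$; (2) $x\leq y\wedge y\leq x\rightarrow x=y$; (3) $x\leq y\wedge y\leq z\rightarrow x\leq z$; (4) $x+y=y+x$; (5) $x\leq x+y$; (6) $x\leq z\wedge y\leq z\rightarrow x+y\leq z$; (7) $0\leq x$; (8) $x\leq 1$; (9) $xCy\rightarrow x\neq 0$; (10) $xCy\rightarrow yCx$; (11) $xC(y+z)\rightarrow xCy$ or $xCz$; (12) $xCy\wedge y\leq y'\rightarrow xCy'$; (13) $x\neq 0\rightarrow xCx$; (ad) if $x\leq a+b$ then there exist $a'\leq a$, $b'\leq b$ with $x=a'+b'$. Finite joins are unambiguous since $x+y$ is the least upper bound of $x,y$. -}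

module Defs where

open import Level using (Level; suc; _⊔_)
open import Data.Nat using (ℕ) renaming (suc to sucℕ)
open import Data.Fin using (Fin) renaming (zero to fzero; suc to fsuc)
open import Data.Product using (Σ; _×_; _,_)
open import Data.Sum using (_⊎_)
open import Relation.Binary.PropositionalEquality using (_≡_)
open import Relation.Nullary using (¬_)

record DCJS (c ℓ₁ ℓ₂ : Level) : Set (suc (c ⊔ ℓ₁ ⊔ ℓ₂)) where
  infix  4 _≤_ _C_
  infixl 6 _+_
  field
    Carrier : Set c
    _≤_     : Carrier → Carrier → Set ℓ₁
    𝟘 𝟙     : Carrier
    _+_     : Carrier → Carrier → Carrier
    _C_     : Carrier → Carrier → Set ℓ₂
    ≤-refl    : ∀ x → x ≤ x
    ≤-antisym : ∀ {x y} → x ≤ y → y ≤ x → x ≡ y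
    ≤-trans   : ∀ {x y z} → x ≤ y → y ≤ z → x ≤ z
    +-comm    : ∀ x y → x + y ≡ y + x
    x≤x+y     : ∀ x y → x ≤ x + y
    +-lub     : ∀ {x y z} → x ≤ z → y ≤ z → x + y ≤ z
    𝟘-least   : ∀ x → 𝟘 ≤ x
    𝟙-greatest : ∀ x → x ≤ 𝟙
    C-nonzero : ∀ {x y} → x C y → ¬ (x ≡ 𝟘)
    C-sym     : ∀ {x y} → x C y → y C x
    C-join    : ∀ {x y z} → x C (y + z) → (x C y) ⊎ (x C z)
    C-mono    : ∀ {x y y'} → x C y → y ≤ y' → x C y'
    C-refl    : ∀ {x} → ¬ (x ≡ 𝟘) → x C x
    ad        : ∀ {x a b} → x ≤ a + b →
                Σ Carrier λ a' → Σ Carrier λ b' → a' ≤ a × b' ≤ b × x ≡ a' + b'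

  ⨆ : (k : ℕ) → (Fin (sucℕ k) → Carrier) → Carrier
  ⨆ ℕ.zero     t = t fzero
  ⨆ (sucℕ k)   t = t fzero + ⨆ k (λ j → t (fsuc j))

-- Refine the covers one at a time.  A decomposition of x into finitely many pieces, each below
-- a member of each of the covers s₂, …, s_m, is refined by the remaining cover s₁: every piece
-- a ≤ x ≤ s₁¹ + ⋯ + s₁ⁱ splits, by repeated use of (ad), into parts each below some s₁ˡ, and
-- the join of all these parts is again x.
module Submission where

open import Defs
open import Level using (Level; _⊔_)
open import Data.Nat using (ℕ; zero; suc)
open import Data.Fin using (Fin) renaming (zero to fzero; suc to fsuc)
open import Data.Vec.Functional using (_∷_)
open import Data.Product using (Σ; _×_; _,_)
open import Relation.Binary.PropositionalEquality using (_≡_; refl; trans; cong; subst)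

module DecompositionTheory {c ℓ₁ ℓ₂ : Level} (D : DCJS c ℓ₁ ℓ₂) where
  open DCJS D

  y≤x+y : ∀ x y → y ≤ x + y
  y≤x+y x y = subst (y ≤_) (+-comm y x) (x≤x+y y x)

  ≡⇒≤ : ∀ {x y} → x ≡ y → x ≤ y
  ≡⇒≤ {x} refl = ≤-refl x

  +-assoc : ∀ x y z → (x + y) + z ≡ x + (y + z)
  +-assoc x y z = ≤-antisym
    (+-lub (+-lub (x≤x+y x _) (≤-trans (x≤x+y y z) (y≤x+y x _)))
           (≤-trans (y≤x+y y z) (y≤x+y x _)))
    (+-lub (≤-trans (x≤x+y x y) (x≤x+y _ z))
           (+-lub (≤-trans (y≤x+y x y) (x≤x+y _ z)) (y≤x+y _ z)))

  ≤-⨆ : ∀ n (t : Fin (suc n) → Carrier) j → t j ≤ ⨆ n t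
  ≤-⨆ zero    t fzero    = ≤-refl _
  ≤-⨆ (suc n) t fzero    = x≤x+y _ _
  ≤-⨆ (suc n) t (fsuc j) = ≤-trans (≤-⨆ n (λ k → t (fsuc k)) j) (y≤x+y _ _)

  record Decomposition {p} (P : Carrier → Set p) (x : Carrier) : Set (c ⊔ p) where
    constructor decomposition
    field
      n′     : ℕ
      pieces : Fin (suc n′) → Carrier
      x≡⨆    : x ≡ ⨆ n′ pieces
      pieces-P : ∀ j → P (pieces j)

  module _ {p} {P : Carrier → Set p} where

    decomposition-single : ∀ {x} → P x → Decomposition P x
    decomposition-single {x} px = decomposition 0 (λ _ → x) refl (λ _ → px)

    decomposition-⨆+ : ∀ n (t : Fin (suc n) → Carrier) {y} →
                       (∀ j → P (t j)) → Decomposition P y → Decomposition P (⨆ n t + y)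
    decomposition-⨆+ zero t pt (decomposition N T refl pT) =
      decomposition (suc N) (t fzero ∷ T) refl λ { fzero → pt fzero ; (fsuc j) → pT j }
    decomposition-⨆+ (suc n) t {y} pt dy
      with decomposition N T y′≡⨆ pT ← decomposition-⨆+ n (λ j → t (fsuc j)) (λ j → pt (fsuc j)) dy =
      decomposition (suc N) (t fzero ∷ T)
        (trans (+-assoc (t fzero) _ y) (cong (t fzero +_) y′≡⨆))
        λ { fzero → pt fzero ; (fsuc j) → pT j }

    decomposition-+ : ∀ {x y} → Decomposition P x → Decomposition P y → Decomposition P (x + y)
    decomposition-+ (decomposition n t refl pt) = decomposition-⨆+ n t pt

  module _ {p q} {P : Carrier → Set p} {Q : Carrier → Set q} where

    decomposition-map≤ : ∀ {x} → (∀ a → P a → a ≤ x → Q a) →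
                         Decomposition P x → Decomposition Q x
    decomposition-map≤ f (decomposition n t refl pt) =
      decomposition n t refl λ j → f (t j) (pt j) (≤-⨆ n t j)

    decomposition-refine : ∀ {x} → (∀ a → P a → a ≤ x → Decomposition Q a) →
                           Decomposition P x → Decomposition Q x
    decomposition-refine f (decomposition n t refl pt) = go n t pt f
      where
      go : ∀ n (t : Fin (suc n) → Carrier) → (∀ j → P (t j)) →
           (∀ a → P a → a ≤ ⨆ n t → Decomposition Q a) → Decomposition Q (⨆ n t)
      go zero    t pt f = f (t fzero) (pt fzero) (≤-refl _)
      go (suc n) t pt f = decomposition-+
        (f (t fzero) (pt fzero) (x≤x+y _ _))
        (go n (λ j → t (fsuc j)) (λ j → pt (fsuc j))
            λ a pa a≤ → f a pa (≤-trans a≤ (y≤x+y _ _)))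

  BelowSome : ∀ {k} → (Fin (suc k) → Carrier) → Carrier → Set ℓ₁
  BelowSome {k} u a = Σ (Fin (suc k)) λ l → a ≤ u l

  ≤-⨆⇒decomposition : ∀ k (u : Fin (suc k) → Carrier) {y} →
                      y ≤ ⨆ k u → Decomposition (BelowSome u) y
  ≤-⨆⇒decomposition zero    u y≤u₀ = decomposition-single (fzero , y≤u₀)
  ≤-⨆⇒decomposition (suc k) u y≤⨆ with ad y≤⨆
  ... | a , b , a≤u₀ , b≤⨆ , refl = decomposition-+
    (decomposition-single (fzero , a≤u₀))
    (decomposition-map≤ (λ { _ (l , h) _ → fsuc l , h })
      (≤-⨆⇒decomposition k (λ j → u (fsuc j)) b≤⨆))

  BelowEach : ∀ {m i} → (Fin (suc m) → Fin (suc i) → Carrier) → Carrier → Set ℓ₁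
  BelowEach {m} {i} s a = Σ (Fin (suc m) → Fin (suc i)) λ l → ∀ r → a ≤ s r (l r)

  common-refinement : ∀ m i (s : Fin (suc m) → Fin (suc i) → Carrier) {x} →
                      (∀ r → x ≤ ⨆ i (s r)) → Decomposition (BelowEach s) x
  common-refinement zero i s x≤s =
    decomposition-map≤ (λ { _ (l , a≤) _ → (λ _ → l) , λ { fzero → a≤ } })
      (≤-⨆⇒decomposition i (s fzero) (x≤s fzero))
  common-refinement (suc m) i s {x} x≤s =
    decomposition-refine refinePiece
      (common-refinement m i (λ r → s (fsuc r)) (λ r → x≤s (fsuc r)))
    where
    refinePiece : ∀ a → BelowEach (λ r → s (fsuc r)) a → a ≤ x → Decomposition (BelowEach s) a
    refinePiece a (l , a≤) a≤x =
      decomposition-map≤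
        (λ { b (l₀ , b≤) b≤a → l₀ ∷ l , λ { fzero → b≤ ; (fsuc r) → ≤-trans b≤a (a≤ r) } })
        (≤-⨆⇒decomposition i (s fzero) (≤-trans a≤x (x≤s fzero)))

mainTheorem14 : ∀ {c ℓ₁ ℓ₂ : Level} (D : DCJS c ℓ₁ ℓ₂) →
    let open DCJS D in
    (m' i' : ℕ) (x : Carrier) (s : Fin (suc m') → Fin (suc i') → Carrier) →
    (∀ j → x ≡ ⨆ i' (s j)) →
    Σ ℕ λ n' → Σ (Fin (suc n') → Carrier) λ t →
      (x ≡ ⨆ n' t) ×
      (∀ j → Σ (Fin (suc m') → Fin (suc i')) λ l → ∀ r → t j ≤ s r (l r))
mainTheorem14 D m' i' x s x≡s = n′ , pieces , x≡⨆ , pieces-P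
  where
  open DecompositionTheory D
  open Decomposition (common-refinement m' i' s (λ r → ≡⇒≤ (x≡s r)))
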